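{- Let $G=(V,E)$ be a DAG with source $s$ and sink $t$ such that every vertex lies on a directed path from $s$ to $t$, and $w:E\to\mathbb{Q}$. Let $f$ be a feasible solution of the flow LP, let $x$ be a maximum flow from $t$ to $s$ in the residual graph $G_f$, and let $\overline{f}=f\oplus x$. Then $\overline{f}$ is an optimal solution of the flow LP.
   Context: Flow LP: add a new edge $ts$; variables $f_e$ for $e\in E\cup\{ts\}$; minimize $f_{ts}$ subject to flow conservation $\sum_{u:uv\in E\cup\{ts\}}f_{uv}=\sum_{u:vu\in E\cup\{ts\}}f_{vu}$ at every $v\in V$, and $f_{uv}\ge w_{uv}$ for all $uv\in E$. Residual graph $G_f$ of a feasible $f$: vertex set $V$; every edge $uv\in E$ with infinite capacity; and for each $uv\in E$ with $f_{uv}>w_{uv}$, an edge $vu$ of capacity $f_{uv}-w_{uv}$. A flow $x$ from $t$ to $s$ in $G_f$ satisfies capacities and conservation except at $s,t$; a maximum flow maximizes its value. The combination $\overline{f}=f\oplus x$ is defined on $uv\in E$ by $\overline{f}_{uv}=f_{uv}+x_{uv}-x_{vu}$ if $vu$ is an edge of $G_f$, and $\overline{f}_{uv}=f_{uv}+x_{uv}$ otherwise; $\overline{f}_{ts}$ is $f_{ts}$ minus the value of $x$. -}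

module Defs where

open import Data.Bool using (Bool; true; false; if_then_else_; _∨_; _∧_)
open import Data.Fin using (Fin)
open import Data.Fin.Properties using () renaming (_≟_ to _≟ᶠ_)
open import Data.Maybe using (Maybe; just; nothing)
open import Data.Nat using (ℕ; zero; suc)
open import Data.Product using (_×_)
open import Data.Rational using (ℚ; 0ℚ; _+_; _-_; _≤_; _<_)
open import Data.Rational.Properties using (_<?_)
open import Data.Empty using (⊥)
open import Relation.Nullary using (¬_)
open import Relation.Nullary.Decidable using (⌊_⌋)
open import Relation.Binary.PropositionalEquality using (_≡_)

Digraph : ℕ → Set
Digraph n = Fin n → Fin n → Bool

Edge : ∀ {n} → Digraph n → Fin n → Fin n → Set
Edge A u v = A u v ≡ true

Σᵥ : ∀ {n} → (Fin n → ℚ) → ℚ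
Σᵥ {zero}  g = 0ℚ
Σᵥ {suc n} g = g Fin.zero + Σᵥ {n} (λ i → g (Fin.suc i))

inflow : ∀ {n} → Digraph n → (Fin n → Fin n → ℚ) → Fin n → ℚ
inflow A x v = Σᵥ (λ u → if A u v then x u v else 0ℚ)

outflow : ∀ {n} → Digraph n → (Fin n → Fin n → ℚ) → Fin n → ℚ
outflow A x v = Σᵥ (λ u → if A v u then x v u else 0ℚ)

data Reach {n} (A : Digraph n) : Fin n → Fin n → Set where
  here  : ∀ {u} → Reach A u u
  there : ∀ {u v w} → Edge A u v → Reach A v w → Reach A u w

data Reach⁺ {n} (A : Digraph n) : Fin n → Fin n → Set where
  step : ∀ {u v w} → Edge A u v → Reach A v w → Reach⁺ A u w

IsDAG : ∀ {n} → Digraph n → Set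
IsDAG A = ∀ v → ¬ Reach⁺ A v v

IsSource : ∀ {n} → Digraph n → Fin n → Set
IsSource A s = ∀ u → ¬ Edge A u s

IsSink : ∀ {n} → Digraph n → Fin n → Set
IsSink A t = ∀ v → ¬ Edge A t v

AllOnSTPath : ∀ {n} → Digraph n → Fin n → Fin n → Set
AllOnSTPath A s t = ∀ v → Reach A s v × Reach A v t

-- The flow LP.  A candidate solution assigns a value to every edge of E
-- (values at non-edges are irrelevant) and a value to the extra edge ts.

record LPSol (n : ℕ) : Set where
  constructor lpsol
  field
    fl  : Fin n → Fin n → ℚ
    fts : ℚ

open LPSol public

-- indicator contribution of the extra edge ts at a vertex
[_≡ᵛ_]· : ∀ {n} → Fin n → Fin n → ℚ → ℚ
[ v ≡ᵛ a ]· q = if ⌊ v ≟ᶠ a ⌋ then q else 0ℚ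

Feasible : ∀ {n} → Digraph n → (Fin n → Fin n → ℚ) → Fin n → Fin n → LPSol n → Set
Feasible A w s t f =
  (∀ v → inflow A (fl f) v + [ v ≡ᵛ s ]· (fts f)
       ≡ outflow A (fl f) v + [ v ≡ᵛ t ]· (fts f))
  × (∀ u v → Edge A u v → w u v ≤ fl f u v)

Optimal : ∀ {n} → Digraph n → (Fin n → Fin n → ℚ) → Fin n → Fin n → LPSol n → Set
Optimal A w s t f =
  Feasible A w s t f × (∀ g → Feasible A w s t g → fts f ≤ fts g)

-- Capacitated digraphs and flows.  Capacity nothing = infinite.

_≤∞_ : ℚ → Maybe ℚ → Set
q ≤∞ just c  = q ≤ c
q ≤∞ nothing = Data.Unit.⊤
  where import Data.Unit

IsFlow : ∀ {n} → Digraph n → (Fin n → Fin n → Maybe ℚ) → Fin n → Fin n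
       → (Fin n → Fin n → ℚ) → Set
IsFlow A cap a b x =
  (∀ u v → Edge A u v → (0ℚ ≤ x u v) × (x u v ≤∞ cap u v))
  × (∀ v → ¬ v ≡ a → ¬ v ≡ b → inflow A x v ≡ outflow A x v)

flowValue : ∀ {n} → Digraph n → Fin n → (Fin n → Fin n → ℚ) → ℚ
flowValue A a x = outflow A x a - inflow A x a

IsMaxFlow : ∀ {n} → Digraph n → (Fin n → Fin n → Maybe ℚ) → Fin n → Fin n
          → (Fin n → Fin n → ℚ) → Set
IsMaxFlow A cap a b x =
  IsFlow A cap a b x
  × (∀ y → IsFlow A cap a b y → flowValue A a y ≤ flowValue A a x)

-- Residual graph G_f: every uv ∈ E with infinite capacity, and for uv ∈ E
-- with f_uv > w_uv the reverse edge vu with capacity f_uv - w_uv.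

revEdge : ∀ {n} → Digraph n → (Fin n → Fin n → ℚ) → LPSol n → Fin n → Fin n → Bool
revEdge A w f u v = A v u ∧ ⌊ w v u <? fl f v u ⌋

residual : ∀ {n} → Digraph n → (Fin n → Fin n → ℚ) → LPSol n → Digraph n
residual A w f u v = A u v ∨ revEdge A w f u v

residualCap : ∀ {n} → Digraph n → (Fin n → Fin n → ℚ) → LPSol n
            → Fin n → Fin n → Maybe ℚ
residualCap A w f u v =
  if A u v then nothing else just (fl f v u - w v u)

_⊕⟨_,_,_⟩_ : ∀ {n} → LPSol n → Digraph n → (Fin n → Fin n → ℚ) → Fin n
           → (Fin n → Fin n → ℚ) → LPSol n
f ⊕⟨ A , w , t ⟩ x = lpsol
  (λ u v → if residual A w f v u
             then fl f u v + x u v - x v u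
             else fl f u v + x u v)
  (fts f - flowValue (residual A w f) t x)

-- Write net z v for the inflow minus the outflow of an edge function z at v.
-- Conservation in the flow LP says that fl g carries fts g from s to t: its net is
-- fts g at t, -(fts g) at s and 0 elsewhere; a maximum residual flow x carries its
-- value from t to s in G_f.
--
-- On E, f ⊕ x is f plus an edge function with the same net as x (this needs E to
-- have no antiparallel edges, which is all that acyclicity is used for), so it
-- carries fts f - val x from s to t; the capacity f_uv - w_uv of a reverse edge
-- keeps it above w.  Conversely, for any feasible g the difference g - f is a
-- residual flow from t to s of value fts f - fts g: its positive part runs along E
-- and its negative part along reverse edges, where g ≥ w gives the capacity bound.
-- Maximality of x then yields fts f - val x ≤ fts g.

module Submission where

open import Defs
open import Data.Nat using (ℕ)
open import Data.Fin using (Fin)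
open import Data.Rational using (ℚ)
open import Relation.Nullary using (¬_)
open import Relation.Binary.PropositionalEquality using (_≡_)

open import Data.Bool using (Bool; true; false; if_then_else_)
open import Data.Empty using (⊥-elim)
open import Data.Fin using (zero; suc)
open import Data.Fin.Properties using () renaming (_≟_ to _≟ᶠ_)
open import Data.Maybe using (Maybe)
open import Data.Product using (_×_; _,_; proj₁; proj₂)
open import Data.Rational using (0ℚ; _+_; _-_; -_; _≤_; _⊔_)
open import Data.Rational.Properties
open import Algebra.Properties.Group +-0-group using (x∙y⁻¹≈ε⇒x≈y; x≈y⇒x∙y⁻¹≈ε; inverseʳ-unique; ⁻¹-involutive)
open import Algebra.Properties.AbelianGroup +-0-abelianGroup using (⁻¹-anti-homo‿-)
open import Data.Sum using (inj₁; inj₂)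
open import Data.Unit using (tt)
open import Relation.Binary.PropositionalEquality using (refl; sym; trans; cong; cong₂; ≢-sym; module ≡-Reasoning)
open import Relation.Nullary using (yes; no)
open import Relation.Nullary.Decidable using (dec⇒maybe)
open import Tactic.RingSolver using (solve-∀)
open import Tactic.RingSolver.Core.AlmostCommutativeRing using (AlmostCommutativeRing; fromCommutativeRing)

ℚ-ring : AlmostCommutativeRing _ _
ℚ-ring = fromCommutativeRing +-*-commutativeRing (λ q → dec⇒maybe (0ℚ ≟ q))

[p+q]+[r+s]≡[p+r]+[q+s] : ∀ p q r s → (p + q) + (r + s) ≡ (p + r) + (q + s)
[p+q]+[r+s]≡[p+r]+[q+s] = solve-∀ ℚ-ring

[p-q]+[r-s]≡[p+r]-[q+s] : ∀ p q r s → (p - q) + (r - s) ≡ (p + r) - (q + s)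
[p-q]+[r-s]≡[p+r]-[q+s] = solve-∀ ℚ-ring

[p-q]-[r-s]≡[p-r]-[q-s] : ∀ p q r s → (p - q) - (r - s) ≡ (p - r) - (q - s)
[p-q]-[r-s]≡[p-r]-[q-s] = solve-∀ ℚ-ring

[p-q]-[r-s]≡[p+s]-[q+r] : ∀ p q r s → (p - q) - (r - s) ≡ (p + s) - (q + r)
[p-q]-[r-s]≡[p+s]-[q+r] = solve-∀ ℚ-ring

[p-q]+[r-s]≡[p-s]-[q-r] : ∀ p q r s → (p - q) + (r - s) ≡ (p - s) - (q - r)
[p-q]+[r-s]≡[p-s]-[q-r] = solve-∀ ℚ-ring

[p-q]-[r-s]≡[s-q]-[r-p] : ∀ p q r s → (p - q) - (r - s) ≡ (s - q) - (r - p)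
[p-q]-[r-s]≡[s-q]-[r-p] = solve-∀ ℚ-ring

p-[p-q]≡q : ∀ p q → p - (p - q) ≡ q
p-[p-q]≡q = solve-∀ ℚ-ring

+≡+⇒-≡- : ∀ {p q r s} → p + s ≡ q + r → p - q ≡ r - s
+≡+⇒-≡- {p} {q} {r} {s} eq =
  x∙y⁻¹≈ε⇒x≈y _ _ (trans ([p-q]-[r-s]≡[p+s]-[q+r] p q r s) (x≈y⇒x∙y⁻¹≈ε eq))

-≡-⇒+≡+ : ∀ {p q r s} → p - q ≡ r - s → p + s ≡ q + r
-≡-⇒+≡+ {p} {q} {r} {s} eq =
  x∙y⁻¹≈ε⇒x≈y _ _ (trans (sym ([p-q]-[r-s]≡[p+s]-[q+r] p q r s)) (x≈y⇒x∙y⁻¹≈ε eq))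

p≤q⇒0≤q-p : ∀ {p q} → p ≤ q → 0ℚ ≤ q - p
p≤q⇒0≤q-p {p} p≤q = ≤-trans (≤-reflexive (sym (+-inverseʳ p))) (+-monoˡ-≤ (- p) p≤q)

p⊔0-[-p]⊔0≡p : ∀ p → (p ⊔ 0ℚ) - ((- p) ⊔ 0ℚ) ≡ p
p⊔0-[-p]⊔0≡p p with ≤-total 0ℚ p
... | inj₁ 0≤p = trans (cong₂ _-_ (p≥q⇒p⊔q≡p 0≤p) (p≤q⇒p⊔q≡q (neg-antimono-≤ 0≤p))) (+-identityʳ p)
... | inj₂ p≤0 = trans (cong₂ _-_ (p≤q⇒p⊔q≡q p≤0) (p≥q⇒p⊔q≡p (neg-antimono-≤ p≤0)))
                       (trans (+-identityˡ _) (⁻¹-involutive p))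

Σᵥ-cong : ∀ {n} {g h : Fin n → ℚ} → (∀ i → g i ≡ h i) → Σᵥ g ≡ Σᵥ h
Σᵥ-cong {ℕ.zero}  _   = refl
Σᵥ-cong {ℕ.suc n} g≗h = cong₂ _+_ (g≗h zero) (Σᵥ-cong (λ i → g≗h (suc i)))

Σᵥ-zero : ∀ n → Σᵥ {n} (λ _ → 0ℚ) ≡ 0ℚ
Σᵥ-zero ℕ.zero    = refl
Σᵥ-zero (ℕ.suc n) = trans (+-identityˡ _) (Σᵥ-zero n)

Σᵥ-distrib-+ : ∀ {n} (g h : Fin n → ℚ) → Σᵥ (λ i → g i + h i) ≡ Σᵥ g + Σᵥ h
Σᵥ-distrib-+ {ℕ.zero}  g h = refl
Σᵥ-distrib-+ {ℕ.suc n} g h = begin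
  (g zero + h zero) + Σᵥ (λ i → g (suc i) + h (suc i))
    ≡⟨ cong ((g zero + h zero) +_) (Σᵥ-distrib-+ (λ i → g (suc i)) (λ i → h (suc i))) ⟩
  (g zero + h zero) + (G + H)
    ≡⟨ [p+q]+[r+s]≡[p+r]+[q+s] (g zero) (h zero) G H ⟩
  (g zero + G) + (h zero + H) ∎
  where
  open ≡-Reasoning
  G = Σᵥ (λ i → g (suc i))
  H = Σᵥ (λ i → h (suc i))

Σᵥ-distrib-minus : ∀ {n} (g h : Fin n → ℚ) → Σᵥ (λ i → g i - h i) ≡ Σᵥ g - Σᵥ h
Σᵥ-distrib-minus {ℕ.zero}  g h = refl
Σᵥ-distrib-minus {ℕ.suc n} g h = begin
  (g zero - h zero) + Σᵥ (λ i → g (suc i) - h (suc i))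
    ≡⟨ cong ((g zero - h zero) +_) (Σᵥ-distrib-minus (λ i → g (suc i)) (λ i → h (suc i))) ⟩
  (g zero - h zero) + (G - H)
    ≡⟨ [p-q]+[r-s]≡[p+r]-[q+s] (g zero) (h zero) G H ⟩
  (g zero + G) - (h zero + H) ∎
  where
  open ≡-Reasoning
  G = Σᵥ (λ i → g (suc i))
  H = Σᵥ (λ i → h (suc i))

Σᵥ-comm : ∀ {m n} (h : Fin m → Fin n → ℚ)
        → Σᵥ (λ i → Σᵥ (λ j → h i j)) ≡ Σᵥ (λ j → Σᵥ (λ i → h i j))
Σᵥ-comm {ℕ.zero}  {n} h = sym (Σᵥ-zero n)
Σᵥ-comm {ℕ.suc m}     h =
  trans (cong (Σᵥ (h zero) +_) (Σᵥ-comm (λ i → h (suc i))))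
        (sym (Σᵥ-distrib-+ (h zero) (λ j → Σᵥ (λ i → h (suc i) j))))

indicator-self : ∀ {n} (a : Fin n) q → [ a ≡ᵛ a ]· q ≡ q
indicator-self a q with a ≟ᶠ a
... | yes _   = refl
... | no  a≢a = ⊥-elim (a≢a refl)

indicator-other : ∀ {n} {v a : Fin n} q → ¬ v ≡ a → [ v ≡ᵛ a ]· q ≡ 0ℚ
indicator-other {v = v} {a} q v≢a with v ≟ᶠ a
... | yes v≡a = ⊥-elim (v≢a v≡a)
... | no  _   = refl

indicator-suc : ∀ {n} (v a : Fin n) q → [ suc v ≡ᵛ suc a ]· q ≡ [ v ≡ᵛ a ]· q
indicator-suc v a q with v ≟ᶠ a
... | yes refl = refl
... | no  _    = refl

indicator-minus : ∀ {n} (v a : Fin n) p q → [ v ≡ᵛ a ]· (p - q) ≡ [ v ≡ᵛ a ]· p - [ v ≡ᵛ a ]· q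
indicator-minus v a p q with v ≟ᶠ a
... | yes _ = refl
... | no  _ = refl

Σᵥ-indicator : ∀ {n} (a : Fin n) q → Σᵥ (λ v → [ v ≡ᵛ a ]· q) ≡ q
Σᵥ-indicator {ℕ.suc n} zero q =
  trans (cong₂ _+_ (indicator-self {ℕ.suc n} zero q)
                   (trans (Σᵥ-cong {n} (λ v → indicator-other {v = suc v} {zero} q (λ ()))) (Σᵥ-zero n)))
        (+-identityʳ q)
Σᵥ-indicator {ℕ.suc n} (suc a) q =
  trans (cong₂ _+_ (indicator-other {v = zero} {suc a} q (λ ()))
                   (trans (Σᵥ-cong (λ v → indicator-suc v a q)) (Σᵥ-indicator a q)))
        (+-identityˡ q)

Σᵥ-supported-on-pair : ∀ {n} {a b : Fin n} (h : Fin n → ℚ) → ¬ a ≡ b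
                     → (∀ v → ¬ v ≡ a → ¬ v ≡ b → h v ≡ 0ℚ)
                     → Σᵥ h ≡ h a + h b
Σᵥ-supported-on-pair {a = a} {b} h a≢b h-vanishes = begin
  Σᵥ h
    ≡⟨ Σᵥ-cong split ⟩
  Σᵥ (λ v → [ v ≡ᵛ a ]· (h a) + [ v ≡ᵛ b ]· (h b))
    ≡⟨ Σᵥ-distrib-+ (λ v → [ v ≡ᵛ a ]· (h a)) (λ v → [ v ≡ᵛ b ]· (h b)) ⟩
  Σᵥ (λ v → [ v ≡ᵛ a ]· (h a)) + Σᵥ (λ v → [ v ≡ᵛ b ]· (h b))
    ≡⟨ cong₂ _+_ (Σᵥ-indicator a (h a)) (Σᵥ-indicator b (h b)) ⟩
  h a + h b ∎
  where
  open ≡-Reasoning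
  split : ∀ v → h v ≡ [ v ≡ᵛ a ]· (h a) + [ v ≡ᵛ b ]· (h b)
  split v with v ≟ᶠ a | v ≟ᶠ b
  ... | yes refl | yes refl = ⊥-elim (a≢b refl)
  ... | yes refl | no _     = sym (+-identityʳ (h v))
  ... | no _     | yes refl = sym (+-identityˡ (h v))
  ... | no v≢a   | no v≢b   = h-vanishes v v≢a v≢b

[_]· : Bool → ℚ → ℚ
[ b ]· q = if b then q else 0ℚ

[]·-cong : ∀ b {p q} → (b ≡ true → p ≡ q) → [ b ]· p ≡ [ b ]· q
[]·-cong true  p≡q = p≡q refl
[]·-cong false _   = refl

[]·-distrib-+ : ∀ b p q → [ b ]· (p + q) ≡ [ b ]· p + [ b ]· q
[]·-distrib-+ true  p q = refl
[]·-distrib-+ false p q = sym (+-identityˡ 0ℚ)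

[]·-distrib-minus : ∀ b p q → [ b ]· (p - q) ≡ [ b ]· p - [ b ]· q
[]·-distrib-minus true  p q = refl
[]·-distrib-minus false p q = sym (+-inverseʳ 0ℚ)

Σᵥ-[]·-distrib-+ : ∀ {n} (b : Fin n → Bool) (p q : Fin n → ℚ)
                 → Σᵥ (λ u → [ b u ]· (p u + q u)) ≡ Σᵥ (λ u → [ b u ]· (p u)) + Σᵥ (λ u → [ b u ]· (q u))
Σᵥ-[]·-distrib-+ b p q =
  trans (Σᵥ-cong (λ u → []·-distrib-+ (b u) (p u) (q u)))
        (Σᵥ-distrib-+ (λ u → [ b u ]· (p u)) (λ u → [ b u ]· (q u)))

Σᵥ-[]·-distrib-minus : ∀ {n} (b : Fin n → Bool) (p q : Fin n → ℚ)
                     → Σᵥ (λ u → [ b u ]· (p u - q u)) ≡ Σᵥ (λ u → [ b u ]· (p u)) - Σᵥ (λ u → [ b u ]· (q u))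
Σᵥ-[]·-distrib-minus b p q =
  trans (Σᵥ-cong (λ u → []·-distrib-minus (b u) (p u) (q u)))
        (Σᵥ-distrib-minus (λ u → [ b u ]· (p u)) (λ u → [ b u ]· (q u)))

net : ∀ {n} → Digraph n → (Fin n → Fin n → ℚ) → Fin n → ℚ
net B z v = inflow B z v - outflow B z v

skew : ∀ {n} → Digraph n → (Fin n → Fin n → ℚ) → Fin n → Fin n → ℚ
skew B z u v = [ B u v ]· (z u v) - [ B v u ]· (z v u)

net≡Σskew : ∀ {n} (B : Digraph n) z v → net B z v ≡ Σᵥ (λ u → skew B z u v)
net≡Σskew B z v = sym (Σᵥ-distrib-minus (λ u → [ B u v ]· (z u v)) (λ u → [ B v u ]· (z v u)))

net-via-skew : ∀ {n} (B : Digraph n) y (C : Digraph n) z v → (∀ u → skew B y u v ≡ skew C z u v)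
             → net B y v ≡ net C z v
net-via-skew B y C z v skew≗ =
  trans (net≡Σskew B y v) (trans (Σᵥ-cong skew≗) (sym (net≡Σskew C z v)))

Σᵥ-net : ∀ {n} (B : Digraph n) z → Σᵥ (net B z) ≡ 0ℚ
Σᵥ-net B z = begin
  Σᵥ (net B z)                         ≡⟨ Σᵥ-distrib-minus (inflow B z) (outflow B z) ⟩
  Σᵥ (inflow B z) - Σᵥ (outflow B z)   ≡⟨ cong (λ q → Σᵥ (inflow B z) - q)
                                               (Σᵥ-comm (λ v u → [ B v u ]· (z v u))) ⟩
  Σᵥ (inflow B z) - Σᵥ (inflow B z)    ≡⟨ +-inverseʳ (Σᵥ (inflow B z)) ⟩
  0ℚ                                   ∎
  where open ≡-Reasoning

net-cong : ∀ {n} (B : Digraph n) {y z} → (∀ {u v} → Edge B u v → y u v ≡ z u v)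
         → ∀ v → net B y v ≡ net B z v
net-cong B y≗z v = cong₂ _-_ (Σᵥ-cong (λ u → []·-cong (B u v) y≗z))
                             (Σᵥ-cong (λ u → []·-cong (B v u) y≗z))

net-+ : ∀ {n} (B : Digraph n) y z v → net B (λ u v → y u v + z u v) v ≡ net B y v + net B z v
net-+ B y z v = begin
  inflow B (λ u v → y u v + z u v) v - outflow B (λ u v → y u v + z u v) v
    ≡⟨ cong₂ _-_ (Σᵥ-[]·-distrib-+ (λ u → B u v) (λ u → y u v) (λ u → z u v))
                 (Σᵥ-[]·-distrib-+ (λ u → B v u) (λ u → y v u) (λ u → z v u)) ⟩
  (inflow B y v + inflow B z v) - (outflow B y v + outflow B z v)
    ≡⟨ sym ([p-q]+[r-s]≡[p+r]-[q+s] (inflow B y v) (outflow B y v) (inflow B z v) (outflow B z v)) ⟩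
  net B y v + net B z v ∎
  where open ≡-Reasoning

net-minus : ∀ {n} (B : Digraph n) y z v → net B (λ u v → y u v - z u v) v ≡ net B y v - net B z v
net-minus B y z v = begin
  inflow B (λ u v → y u v - z u v) v - outflow B (λ u v → y u v - z u v) v
    ≡⟨ cong₂ _-_ (Σᵥ-[]·-distrib-minus (λ u → B u v) (λ u → y u v) (λ u → z u v))
                 (Σᵥ-[]·-distrib-minus (λ u → B v u) (λ u → y v u) (λ u → z v u)) ⟩
  (inflow B y v - inflow B z v) - (outflow B y v - outflow B z v)
    ≡⟨ [p-q]-[r-s]≡[p-r]-[q-s] (inflow B y v) (inflow B z v) (outflow B y v) (outflow B z v) ⟩
  net B y v - net B z v ∎
  where open ≡-Reasoning

record Carries {n} (B : Digraph n) (z : Fin n → Fin n → ℚ) (a b : Fin n) (q : ℚ) : Set where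
  constructor carrying
  field net-at : ∀ v → net B z v ≡ [ v ≡ᵛ b ]· q - [ v ≡ᵛ a ]· q

open Carries

feasible-carries : ∀ {n} {A : Digraph n} {w s t} {g : LPSol n}
                 → Feasible A w s t g → Carries A (fl g) s t (fts g)
feasible-carries {A = A} {s = s} {t} {g} (conservation , _) = carrying λ v →
  +≡+⇒-≡- {inflow A (fl g) v} {outflow A (fl g) v} {[ v ≡ᵛ t ]· (fts g)} {[ v ≡ᵛ s ]· (fts g)}
    (conservation v)

carries-conservation : ∀ {n} {A : Digraph n} {z s t q} → Carries A z s t q
                     → ∀ v → inflow A z v + [ v ≡ᵛ s ]· q ≡ outflow A z v + [ v ≡ᵛ t ]· q
carries-conservation {A = A} {z} {s} {t} {q} z-carries v =
  -≡-⇒+≡+ {inflow A z v} {outflow A z v} {[ v ≡ᵛ t ]· q} {[ v ≡ᵛ s ]· q} (net-at z-carries v)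

carries-conserved : ∀ {n} {B : Digraph n} {z a b q} → Carries B z a b q
                  → ∀ {v} → ¬ v ≡ a → ¬ v ≡ b → inflow B z v ≡ outflow B z v
carries-conserved {B = B} {z} {a} {b} {q} z-carries {v} v≢a v≢b = x∙y⁻¹≈ε⇒x≈y _ _ (begin
  net B z v                         ≡⟨ net-at z-carries v ⟩
  [ v ≡ᵛ b ]· q - [ v ≡ᵛ a ]· q     ≡⟨ cong₂ _-_ (indicator-other q v≢b) (indicator-other q v≢a) ⟩
  0ℚ - 0ℚ                           ≡⟨ +-inverseʳ 0ℚ ⟩
  0ℚ                                ∎)
  where open ≡-Reasoning

carries-value : ∀ {n} {B : Digraph n} {z a b q} → ¬ a ≡ b → Carries B z a b q → flowValue B a z ≡ q
carries-value {B = B} {z} {a} {b} {q} a≢b z-carries = begin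
  outflow B z a - inflow B z a   ≡⟨ sym (⁻¹-anti-homo‿- (inflow B z a) (outflow B z a)) ⟩
  - net B z a                    ≡⟨ cong -_ (net-at z-carries a) ⟩
  - ([ a ≡ᵛ b ]· q - [ a ≡ᵛ a ]· q) ≡⟨ cong (λ r → - (r - [ a ≡ᵛ a ]· q)) (indicator-other q a≢b) ⟩
  - (0ℚ - [ a ≡ᵛ a ]· q)         ≡⟨ ⁻¹-anti-homo‿- 0ℚ ([ a ≡ᵛ a ]· q) ⟩
  [ a ≡ᵛ a ]· q - 0ℚ             ≡⟨ +-identityʳ _ ⟩
  [ a ≡ᵛ a ]· q                  ≡⟨ indicator-self a q ⟩
  q                              ∎
  where open ≡-Reasoning

flow-carries : ∀ {n} (B : Digraph n) {a b} z → ¬ a ≡ b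
             → (∀ v → ¬ v ≡ a → ¬ v ≡ b → inflow B z v ≡ outflow B z v)
             → Carries B z a b (flowValue B a z)
flow-carries B {a} {b} z a≢b conserved = carrying carries
  where
  net-vanishes : ∀ v → ¬ v ≡ a → ¬ v ≡ b → net B z v ≡ 0ℚ
  net-vanishes v v≢a v≢b = x≈y⇒x∙y⁻¹≈ε (conserved v v≢a v≢b)

  net-at-b : net B z b ≡ flowValue B a z
  net-at-b = trans (inverseʳ-unique (net B z a) (net B z b)
                      (trans (sym (Σᵥ-supported-on-pair (net B z) a≢b net-vanishes)) (Σᵥ-net B z)))
                   (⁻¹-anti-homo‿- (inflow B z a) (outflow B z a))

  carries : ∀ v → net B z v ≡ [ v ≡ᵛ b ]· (flowValue B a z) - [ v ≡ᵛ a ]· (flowValue B a z)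
  carries v with v ≟ᶠ a | v ≟ᶠ b
  ... | yes refl | yes refl = ⊥-elim (a≢b refl)
  ... | yes refl | no _     = trans (sym (⁻¹-anti-homo‿- (outflow B z a) (inflow B z a)))
                                    (sym (+-identityˡ _))
  ... | no _     | yes refl = trans net-at-b (sym (+-identityʳ _))
  ... | no v≢a   | no v≢b   = trans (net-vanishes v v≢a v≢b) (sym (+-inverseʳ 0ℚ))

carries-+ : ∀ {n} {B C D : Digraph n} {x y z a b p q}
          → Carries B y a b p → Carries C z b a q
          → (∀ v → net D x v ≡ net B y v + net C z v)
          → Carries D x a b (p - q)
carries-+ {B = B} {C} {D} {x} {y} {z} {a} {b} {p} {q} y-carries z-carries x-net = carrying λ v → begin
  net D x v                                                   ≡⟨ x-net v ⟩
  net B y v + net C z v                                       ≡⟨ cong₂ _+_ (net-at y-carries v) (net-at z-carries v) ⟩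
  ([ v ≡ᵛ b ]· p - [ v ≡ᵛ a ]· p) + ([ v ≡ᵛ a ]· q - [ v ≡ᵛ b ]· q)
    ≡⟨ [p-q]+[r-s]≡[p-s]-[q-r] ([ v ≡ᵛ b ]· p) ([ v ≡ᵛ a ]· p) ([ v ≡ᵛ a ]· q) ([ v ≡ᵛ b ]· q) ⟩
  ([ v ≡ᵛ b ]· p - [ v ≡ᵛ b ]· q) - ([ v ≡ᵛ a ]· p - [ v ≡ᵛ a ]· q)
    ≡⟨ sym (cong₂ _-_ (indicator-minus v b p q) (indicator-minus v a p q)) ⟩
  [ v ≡ᵛ b ]· (p - q) - [ v ≡ᵛ a ]· (p - q)                   ∎
  where open ≡-Reasoning

carries-minus : ∀ {n} {B C D : Digraph n} {x y z a b p q}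
              → Carries B y a b p → Carries C z a b q
              → (∀ v → net D x v ≡ net B y v - net C z v)
              → Carries D x b a (q - p)
carries-minus {B = B} {C} {D} {x} {y} {z} {a} {b} {p} {q} y-carries z-carries x-net = carrying λ v → begin
  net D x v                                                   ≡⟨ x-net v ⟩
  net B y v - net C z v                                       ≡⟨ cong₂ _-_ (net-at y-carries v) (net-at z-carries v) ⟩
  ([ v ≡ᵛ b ]· p - [ v ≡ᵛ a ]· p) - ([ v ≡ᵛ b ]· q - [ v ≡ᵛ a ]· q)
    ≡⟨ [p-q]-[r-s]≡[s-q]-[r-p] ([ v ≡ᵛ b ]· p) ([ v ≡ᵛ a ]· p) ([ v ≡ᵛ b ]· q) ([ v ≡ᵛ a ]· q) ⟩
  ([ v ≡ᵛ a ]· q - [ v ≡ᵛ a ]· p) - ([ v ≡ᵛ b ]· q - [ v ≡ᵛ b ]· p)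
    ≡⟨ sym (cong₂ _-_ (indicator-minus v a q p) (indicator-minus v b q p)) ⟩
  [ v ≡ᵛ a ]· (q - p) - [ v ≡ᵛ b ]· (q - p)                   ∎
  where open ≡-Reasoning

IsDAG⇒antisymmetric : ∀ {n} {A : Digraph n} → IsDAG A → ∀ {u v} → Edge A u v → A v u ≡ false
IsDAG⇒antisymmetric {A = A} acyclic {u} {v} uv with A v u in vu
... | true  = ⊥-elim (acyclic u (step uv (there vu here)))
... | false = refl

module Residual {n} (A : Digraph n) (w : Fin n → Fin n → ℚ) (s t : Fin n) (f : LPSol n)
                (antisymmetric : ∀ {u v} → Edge A u v → A v u ≡ false) where

  Gf : Digraph n
  Gf = residual A w f

  cap : Fin n → Fin n → Maybe ℚ
  cap = residualCap A w f

  RespectsWeights : LPSol n → Set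
  RespectsWeights g = ∀ u v → Edge A u v → w u v ≤ fl g u v

  WithinCapacity : (Fin n → Fin n → ℚ) → Set
  WithinCapacity x = ∀ u v → Edge Gf u v → (0ℚ ≤ x u v) × (x u v ≤∞ cap u v)

  forward-residual : ∀ {u v} → Edge A u v → Edge Gf u v
  forward-residual uv rewrite uv = refl

  reverse-capacity : ∀ {u v q} → Edge A u v → q ≤∞ cap v u → q ≤ fl f u v - w u v
  reverse-capacity uv rewrite antisymmetric uv = λ q≤c → q≤c

  push : (Fin n → Fin n → ℚ) → Fin n → Fin n → ℚ
  push x u v = if Gf v u then x u v - x v u else x u v

  fl-⊕ : ∀ x u v → fl (f ⊕⟨ A , w , t ⟩ x) u v ≡ fl f u v + push x u v
  fl-⊕ x u v with Gf v u
  ... | true  = +-assoc (fl f u v) (x u v) (- x v u)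
  ... | false = refl

  skew-push : ∀ x v u → skew A (push x) u v ≡ skew Gf x u v
  skew-push x v u with A u v in uv
  skew-push x v u | true rewrite antisymmetric uv with w u v <? fl f u v
  ... | yes _ = +-identityʳ (x u v - x v u)
  ... | no  _ = refl
  skew-push x v u | false with A v u | w v u <? fl f v u
  ... | true  | yes _ = trans (+-identityˡ _) (⁻¹-anti-homo‿- (x v u) (x u v))
  ... | true  | no  _ = refl
  ... | false | _     = refl

  net-⊕ : ∀ x v → net A (fl (f ⊕⟨ A , w , t ⟩ x)) v ≡ net A (fl f) v + net Gf x v
  net-⊕ x v = begin
    net A (fl (f ⊕⟨ A , w , t ⟩ x)) v        ≡⟨ net-cong A (λ _ → fl-⊕ x _ _) v ⟩
    net A (λ u v → fl f u v + push x u v) v  ≡⟨ net-+ A (fl f) (push x) v ⟩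
    net A (fl f) v + net A (push x) v        ≡⟨ cong (net A (fl f) v +_)
                                                     (net-via-skew A (push x) Gf x v (skew-push x v)) ⟩
    net A (fl f) v + net Gf x v              ∎
    where open ≡-Reasoning

  ⊕-respectsWeights : ∀ {x} → RespectsWeights f → WithinCapacity x
                    → RespectsWeights (f ⊕⟨ A , w , t ⟩ x)
  ⊕-respectsWeights {x} f≥w x-bounded u v uv = ≤-trans lowerBound (≤-reflexive (sym (fl-⊕ x u v)))
    where
    open ≤-Reasoning
    x≥0 : 0ℚ ≤ x u v
    x≥0 = proj₁ (x-bounded u v (forward-residual uv))

    lowerBound : w u v ≤ fl f u v + push x u v
    lowerBound with Gf v u in vu
    ... | true  = begin
      w u v                                  ≡⟨ sym (p-[p-q]≡q (fl f u v) (w u v)) ⟩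
      fl f u v - (fl f u v - w u v)          ≡⟨ cong (fl f u v +_) (sym (+-identityˡ _)) ⟩
      fl f u v + (0ℚ - (fl f u v - w u v))   ≤⟨ +-monoʳ-≤ (fl f u v)
                                                   (+-mono-≤ x≥0 (neg-antimono-≤ reverse≤)) ⟩
      fl f u v + (x u v - x v u)             ∎
      where
      reverse≤ : x v u ≤ fl f u v - w u v
      reverse≤ = reverse-capacity uv (proj₂ (x-bounded v u vu))
    ... | false = begin
      w u v           ≤⟨ f≥w u v uv ⟩
      fl f u v        ≡⟨ sym (+-identityʳ (fl f u v)) ⟩
      fl f u v + 0ℚ   ≤⟨ +-monoʳ-≤ (fl f u v) x≥0 ⟩
      fl f u v + x u v ∎

  ⊕-carries : ¬ s ≡ t → Feasible A w s t f → ∀ {x} → IsFlow Gf cap t s x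
            → Carries A (fl (f ⊕⟨ A , w , t ⟩ x)) s t (fts (f ⊕⟨ A , w , t ⟩ x))
  ⊕-carries s≢t f-feasible {x} (_ , x-conserved) =
    carries-+ (feasible-carries f-feasible) (flow-carries Gf x (≢-sym s≢t) x-conserved) (net-⊕ x)

  ⊕-feasible : ¬ s ≡ t → Feasible A w s t f → ∀ {x} → IsFlow Gf cap t s x
             → Feasible A w s t (f ⊕⟨ A , w , t ⟩ x)
  ⊕-feasible s≢t f-feasible@(_ , f≥w) x-isFlow@(x-bounded , _) =
    carries-conservation (⊕-carries s≢t f-feasible x-isFlow) , ⊕-respectsWeights f≥w x-bounded

  diffFlow : LPSol n → Fin n → Fin n → ℚ
  diffFlow g u v = if A u v then (fl g u v - fl f u v) ⊔ 0ℚ else (fl f v u - fl g v u) ⊔ 0ℚ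

  push-diffFlow : ∀ g → RespectsWeights g
                → ∀ {u v} → Edge A u v → push (diffFlow g) u v ≡ fl g u v - fl f u v
  push-diffFlow g g≥w {u} {v} uv rewrite uv | antisymmetric uv with w u v <? fl f u v
  ... | yes _   = trans (cong (λ r → ((fl g u v - fl f u v) ⊔ 0ℚ) - (r ⊔ 0ℚ))
                              (sym (⁻¹-anti-homo‿- (fl g u v) (fl f u v))))
                        (p⊔0-[-p]⊔0≡p (fl g u v - fl f u v))
  ... | no w≮f = p≥q⇒p⊔q≡p (p≤q⇒0≤q-p (≤-trans (≮⇒≥ w≮f) (g≥w u v uv)))

  diffFlow-bounded : ∀ g → RespectsWeights g → WithinCapacity (diffFlow g)
  diffFlow-bounded g g≥w u v uv-residual with A u v
  ... | true  = p≤q⊔p (fl g u v - fl f u v) 0ℚ , tt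
  ... | false with A v u in vu | w v u <? fl f v u
  ...   | true  | yes w<f = p≤q⊔p (fl f v u - fl g v u) 0ℚ ,
                            ⊔-lub (+-monoʳ-≤ (fl f v u) (neg-antimono-≤ (g≥w v u vu)))
                                  (p≤q⇒0≤q-p (<⇒≤ w<f))
  diffFlow-bounded _ g≥w u v () | false | true  | no _
  diffFlow-bounded _ g≥w u v () | false | false | _

  net-diffFlow : ∀ g → RespectsWeights g
               → ∀ v → net Gf (diffFlow g) v ≡ net A (fl g) v - net A (fl f) v
  net-diffFlow g g≥w v = begin
    net Gf (diffFlow g) v                  ≡⟨ sym (net-via-skew A (push (diffFlow g)) Gf (diffFlow g) v
                                                             (skew-push (diffFlow g) v)) ⟩
    net A (push (diffFlow g)) v            ≡⟨ net-cong A (push-diffFlow g g≥w) v ⟩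
    net A (λ u v → fl g u v - fl f u v) v  ≡⟨ net-minus A (fl g) (fl f) v ⟩
    net A (fl g) v - net A (fl f) v        ∎
    where open ≡-Reasoning

  diffFlow-carries : Feasible A w s t f → ∀ {g} → Feasible A w s t g
                   → Carries Gf (diffFlow g) t s (fts f - fts g)
  diffFlow-carries f-feasible {g} g-feasible@(_ , g≥w) =
    carries-minus (feasible-carries g-feasible) (feasible-carries f-feasible) (net-diffFlow g g≥w)

  ⊕-optimal : ¬ s ≡ t → Feasible A w s t f → ∀ {x} → IsMaxFlow Gf cap t s x
            → ∀ g → Feasible A w s t g → fts (f ⊕⟨ A , w , t ⟩ x) ≤ fts g
  ⊕-optimal s≢t f-feasible {x} (_ , x-maximal) g g-feasible@(_ , g≥w) = begin
    fts f - flowValue Gf t x  ≤⟨ +-monoʳ-≤ (fts f) (neg-antimono-≤ (x-maximal y y-isFlow)) ⟩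
    fts f - flowValue Gf t y  ≡⟨ cong (λ q → fts f - q) (carries-value (≢-sym s≢t) y-carries) ⟩
    fts f - (fts f - fts g)   ≡⟨ p-[p-q]≡q (fts f) (fts g) ⟩
    fts g                     ∎
    where
    open ≤-Reasoning
    y : Fin n → Fin n → ℚ
    y = diffFlow g
    y-carries : Carries Gf y t s (fts f - fts g)
    y-carries = diffFlow-carries f-feasible g-feasible
    y-isFlow : IsFlow Gf cap t s y
    y-isFlow = diffFlow-bounded g g≥w , λ v v≢t v≢s → carries-conserved y-carries v≢t v≢s

proposition2 : (n : ℕ) (A : Digraph n) (s t : Fin n) (w : Fin n → Fin n → ℚ)
    → IsDAG A → IsSource A s → IsSink A t → ¬ s ≡ t → AllOnSTPath A s t
    → (f : LPSol n) → Feasible A w s t f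
    → (x : Fin n → Fin n → ℚ)
    → IsMaxFlow (residual A w f) (residualCap A w f) t s x
    → Optimal A w s t (f ⊕⟨ A , w , t ⟩ x)
proposition2 n A s t w acyclic _ _ s≢t _ f f-feasible x (x-isFlow , x-maximal) =
  ⊕-feasible s≢t f-feasible x-isFlow ,
  ⊕-optimal s≢t f-feasible (x-isFlow , x-maximal)
  where open Residual A w s t f (IsDAG⇒antisymmetric acyclic)
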